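{- Let $k_0,k_1,k_{ -1}$ be positive integers with $k_0$ odd and $k_{ -1},k_1>k_0\geq 3$. Let $\omega=(a_j)_{j\in\mathbb{Z}}\in\{1,2\}^{\mathbb{Z}}$ be such that $a_{ -k_{ -1}-2}=2$, $a_j=1$ for $-k_{ -1}-1\le j\le -2$, $a_{ -1}=a_0=2$, $a_j=1$ for $1\le j\le k_0$, $a_{k_0+1}=a_{k_0+2}=2$, $a_j=1$ for $k_0+3\le j\le k_0+k_1+2$, and $a_{k_0+k_1+3}=2$ (so $\omega=\dots 2\,1^{k_{ -1}}\,22\,1^{k_0}\,22\,1^{k_1}\,2\dots$). Put $A=\lambda_0(\omega)$, $B=\lambda_{k_0+1}(\omega)$, $C=\lambda_{k_0+2}(\omega)$, $D=\lambda_{ -1}(\omega)$. Then: (i) if $k_{ -1}$ is even and $k_1$ is odd, or if $k_1,k_{ -1}$ are both odd and $k_{ -1}>k_1$, then $A>B>3$; (ii) if $k_1,k_{ -1}$ are both even and $k_{ -1}>k_1$, then $B>A>3$; (iii) in every case, $B>C$ and $A>D$.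
   Context: For $\theta=(a_n)_{n\in\mathbb{Z}}\in(\mathbb{N}^*)^{\mathbb{Z}}$, $\lambda_i(\theta)=a_i+[0;a_{i+1},a_{i+2},\dots]+[0;a_{i-1},a_{i-2},\dots]$, where $[0;c_1,c_2,\dots]$ denotes a continued fraction. Thus $A=2+[0;1^{k_0},2,2,1^{k_1},\dots]+[0;2,1^{k_{ -1}},\dots]$, $B=2+[0;2,1^{k_1},\dots]+[0;1^{k_0},2,2,1^{k_{ -1}},\dots]$, $C=2+[0;1^{k_1},\dots]+[0;2,1^{k_0},2,2,\dots]$, $D=2+[0;2,1^{k_0},\dots]+[0;1^{k_{ -1}},2,\dots]$; here $1^k$ denotes $k$ consecutive 1's. -}

module Defs where

open import Data.Nat as ℕ using (ℕ; zero; suc; pred)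
open import Data.Integer as ℤ using (ℤ; +_)
open import Data.Rational.Unnormalised as Q using (ℚᵘ; mkℚᵘ)
open import Data.List using (List; []; _∷_; map; foldr; upTo)
open import Data.Product using (_×_; _,_; ∃-syntax)
open import Relation.Binary.PropositionalEquality using (_≡_)

Even : ℕ → Set
Even k = ∃[ m ] k ≡ 2 ℕ.* m

Odd : ℕ → Set
Odd k = ∃[ m ] k ≡ suc (2 ℕ.* m)

-- Finite continued fraction [0; c₁, …, cₙ] as a pair (p , q') meaning p / (q' + 1).
-- [0;] = 0/1 ;  [0; c, rest] = 1 / (c + p/(q'+1)) = (q'+1) / (c (q'+1) + p).
-- (Correct whenever every partial quotient c ≥ 1, which holds here.)
cfPair : List ℕ → ℕ × ℕ
cfPair [] = 0 , 0
cfPair (c ∷ rest) with cfPair rest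
... | p , q' = suc q' , pred (c ℕ.* suc q' ℕ.+ p)

cf : List ℕ → ℚᵘ
cf cs with cfPair cs
... | p , q' = mkℚᵘ (+ p) q'

λapprox : (ℤ → ℕ) → ℤ → ℕ → ℚᵘ
λapprox θ i n =
  (mkℚᵘ (+ θ i) 0 Q.+ cf (map (λ m → θ (i ℤ.+ + suc m)) (upTo n)))
    Q.+ cf (map (λ m → θ (i ℤ.- + suc m)) (upTo n))

-- A real number given as a (convergent) sequence of rationals.
RSeq : Set
RSeq = ℕ → ℚᵘ

-- Strict order of the limits (Bishop order): eventually y exceeds x by a fixed positive rational.
_<ᵣ_ : RSeq → RSeq → Set
x <ᵣ y = ∃[ ε ] (Q.0ℚᵘ Q.< ε × ∃[ N ] ((n : ℕ) → N ℕ.≤ n → x n Q.+ ε Q.≤ y n))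

const : ℚᵘ → RSeq
const q _ = q

three : RSeq
three = const (mkℚᵘ (+ 3) 0)

lam : (ℤ → ℕ) → ℤ → RSeq
lam θ i = λapprox θ i

-- Prepending a partial quotient c ≥ 1 reverses the order of continued fractions (x ↦ 1/(c + x)), so
-- a common prefix of even length preserves it and one of odd length reverses it; continuations of a
-- fixed prefix by 1⋯ and by 2z⋯ are moreover separated by a fixed gap. With k₀ odd this gives C < B
-- and D < A directly, and 3 < A, B via [0; 2, L] + [0; 1, 1, L] = 1. For A versus B the tails Lα
-- (right of B) and Lβ (left of A) enter through Ψ L = [0; 1^k₀, 2, 2, L] + [0; 1, 1, L], which
-- increases with [0; L] at rate at least 1/64, while truncating a continued fraction after n digits
-- costs at most 3/(n + 3); comparing Lα with Lβ is again a parity argument on their common block of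
-- ones. Reflecting ω about the middle of 1^k₀ exchanges A with B and C with D, so each argument is
-- made only once.

module Submission where

open import Defs
open import Data.Nat as ℕ using (ℕ; zero; suc)
import Data.Nat.Properties as ℕP
import Data.Nat.Tactic.RingSolver as ℕSolver
open import Data.Integer as ℤ using (ℤ; +_; -_; +[1+_]; -[1+_])
import Data.Integer.Properties as ℤP
open import Data.Rational.Unnormalised as Q
  using (ℚᵘ; mkℚᵘ; *≤*; *<*; *≡*; _≃_; _+_; _*_; _-_; _≤_; _<_; 0ℚᵘ; 1ℚᵘ; ½; ∣_∣)
import Data.Rational.Unnormalised.Properties as QP
open import Data.List using (List; []; _∷_; _++_; replicate; length; applyUpTo)
import Data.List.Properties as List
open import Data.List.Relation.Unary.All using (All; []; _∷_)
import Data.List.Relation.Unary.All.Properties as All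
open import Relation.Nullary.Decidable using (dec⇒maybe)
open import Data.Product using (_×_; _,_; proj₁; proj₂; ∃-syntax)
open import Data.Sum using (_⊎_; inj₁; inj₂)
open import Relation.Binary.PropositionalEquality
open import Relation.Binary using (tri<; tri≈; tri>)
open import Data.Empty using (⊥; ⊥-elim)
open import Tactic.RingSolver using (solve-∀)
open import Tactic.RingSolver.Core.AlmostCommutativeRing using (AlmostCommutativeRing; fromCommutativeRing)

ℚᵘ-ring : AlmostCommutativeRing _ _
ℚᵘ-ring = fromCommutativeRing QP.+-*-commutativeRing (λ x → dec⇒maybe (0ℚᵘ QP.≃? x))

⟦_⟧ : ℕ → ℚᵘ
⟦ n ⟧ = mkℚᵘ (+ n) 0

⅓ ¼ ¾ : ℚᵘ
⅓ = mkℚᵘ (+ 1) 2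
¼ = mkℚᵘ (+ 1) 3
¾ = mkℚᵘ (+ 3) 3

0≤+ : ∀ {p q} → 0ℚᵘ ≤ p → 0ℚᵘ ≤ q → 0ℚᵘ ≤ p + q
0≤+ p≥0 q≥0 = QP.+-mono-≤ p≥0 q≥0

0≤* : ∀ {p q} → 0ℚᵘ ≤ p → 0ℚᵘ ≤ q → 0ℚᵘ ≤ p * q
0≤* {p} {q} p≥0 q≥0 = QP.nonNegative⁻¹ _ {{QP.nonNeg*nonNeg⇒nonNeg p {{Q.nonNegative p≥0}} q {{Q.nonNegative q≥0}}}}

0<* : ∀ {p q} → 0ℚᵘ < p → 0ℚᵘ < q → 0ℚᵘ < p * q
0<* {p} {q} p>0 q>0 = QP.positive⁻¹ _ {{QP.pos*pos⇒pos p {{Q.positive p>0}} q {{Q.positive q>0}}}}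

≤-by : ∀ {p q e} → 0ℚᵘ ≤ e → q - p ≃ e → p ≤ q
≤-by {p} {q} {e} e≥0 q-p≃e = begin
  p             ≤⟨ QP.p≤p+q p e {{Q.nonNegative e≥0}} ⟩
  p + e         ≃⟨ QP.+-congʳ p (QP.≃-sym q-p≃e) ⟩
  p + (q - p)   ≃⟨ cancel p q ⟩
  q             ∎
  where
  open QP.≤-Reasoning
  cancel : ∀ p q → p + (q - p) ≃ q
  cancel = solve-∀ ℚᵘ-ring

<-by : ∀ {p q e} → 0ℚᵘ < e → q - p ≃ e → p < q
<-by {p} {q} {e} e>0 q-p≃e = begin-strict
  p             ≃⟨ QP.≃-sym (QP.+-identityʳ p) ⟩
  p + 0ℚᵘ       <⟨ QP.+-monoʳ-< p e>0 ⟩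
  p + e         ≃⟨ QP.+-congʳ p (QP.≃-sym q-p≃e) ⟩
  p + (q - p)   ≃⟨ cancel p q ⟩
  q             ∎
  where
  open QP.≤-Reasoning
  cancel : ∀ p q → p + (q - p) ≃ q
  cancel = solve-∀ ℚᵘ-ring

p<q⇒0<q-p : ∀ {p q} → p < q → 0ℚᵘ < q - p
p<q⇒0<q-p {p} {q} p<q = QP.<-respˡ-≃ (QP.+-inverseʳ p) (QP.+-monoˡ-< (Q.- p) p<q)

p≤∣p∣ : ∀ p → p ≤ ∣ p ∣
p≤∣p∣ p with QP.∣p∣≡p∨∣p∣≡-p p
... | inj₁ ∣p∣≡p  = QP.≤-reflexive-≡ (sym ∣p∣≡p)
... | inj₂ ∣p∣≡-p = QP.≤-trans (QP.neg-cancel-≤ (subst (0ℚᵘ ≤_) ∣p∣≡-p (QP.0≤∣p∣ p))) (QP.0≤∣p∣ p)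

∣p-q∣≤⇒p≤q+ : ∀ p q {e} → ∣ p - q ∣ ≤ e → p ≤ q + e
∣p-q∣≤⇒p≤q+ p q {e} ∣p-q∣≤e = ≤-by (QP.p≤q⇒0≤q-p (QP.≤-trans (p≤∣p∣ (p - q)) ∣p-q∣≤e)) (rearrange p q e)
  where
  rearrange : ∀ p q e → (q + e) - p ≃ e - (p - q)
  rearrange = solve-∀ ℚᵘ-ring

∣p-q∣-comm : ∀ p q → ∣ p - q ∣ ≃ ∣ q - p ∣
∣p-q∣-comm p q = QP.≃-trans (QP.≃-sym (QP.≃-reflexive (QP.∣-p∣≡∣p∣ (p - q)))) (QP.∣-∣-cong (negate p q))
  where
  negate : ∀ p q → Q.- (p - q) ≃ q - p
  negate = solve-∀ ℚᵘ-ring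

*-mono-≤-nonNeg : ∀ {p q r s} → 0ℚᵘ ≤ p → 0ℚᵘ ≤ r → p ≤ q → r ≤ s → p * r ≤ q * s
*-mono-≤-nonNeg p≥0 r≥0 = QP.*-mono-≤-nonNeg {{Q.nonNegative p≥0}} {{Q.nonNegative r≥0}}

-- Continued fractions of digit strings

Digit : ℕ → Set
Digit c = c ≡ 1 ⊎ c ≡ 2

Digits : List ℕ → Set
Digits = All Digit

ones-digits : ∀ k → Digits (replicate k 1)
ones-digits zero = []
ones-digits (suc k) = inj₁ refl ∷ ones-digits k

digit-suc : ∀ {c} → Digit c → ∃[ c' ] c ≡ suc c'
digit-suc (inj₁ refl) = 0 , refl
digit-suc (inj₂ refl) = 1 , refl

+-mkℚᵘ : ∀ a b c d → mkℚᵘ (+ a) b + mkℚᵘ (+ c) d ≡ mkℚᵘ (+ (a ℕ.* suc d ℕ.+ c ℕ.* suc b)) (d ℕ.+ b ℕ.* suc d)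
+-mkℚᵘ a b c d = cong₂ (λ x y → mkℚᵘ (x ℤ.+ y) (d ℕ.+ b ℕ.* suc d)) (sym (ℤP.pos-* a (suc d))) (sym (ℤP.pos-* c (suc b)))

*-mkℚᵘ : ∀ a b c d → mkℚᵘ (+ a) b * mkℚᵘ (+ c) d ≡ mkℚᵘ (+ (a ℕ.* c)) (d ℕ.+ b ℕ.* suc d)
*-mkℚᵘ a b c d = cong (λ x → mkℚᵘ x (d ℕ.+ b ℕ.* suc d)) (sym (ℤP.pos-* a c))

mkℚᵘ-≃ : ∀ {a b c d} → a ℕ.* suc d ≡ c ℕ.* suc b → mkℚᵘ (+ a) b ≃ mkℚᵘ (+ c) d
mkℚᵘ-≃ {a} {b} {c} {d} eq = *≡* (trans (sym (ℤP.pos-* a (suc d))) (trans (cong +_ eq) (ℤP.pos-* c (suc b))))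

mkℚᵘ-≤ : ∀ {a b c d} → a ℕ.* suc d ℕ.≤ c ℕ.* suc b → mkℚᵘ (+ a) b ≤ mkℚᵘ (+ c) d
mkℚᵘ-≤ {a} {b} {c} {d} le = *≤* (subst₂ ℤ._≤_ (ℤP.pos-* a (suc d)) (ℤP.pos-* c (suc b)) (ℤ.+≤+ le))

mkℚᵘ-< : ∀ {a b c d} → a ℕ.* suc d ℕ.< c ℕ.* suc b → mkℚᵘ (+ a) b < mkℚᵘ (+ c) d
mkℚᵘ-< {a} {b} {c} {d} lt = *<* (subst₂ ℤ._<_ (ℤP.pos-* a (suc d)) (ℤP.pos-* c (suc b)) (ℤ.+<+ lt))

cf-pair : ∀ L → cf L ≡ mkℚᵘ (+ proj₁ (cfPair L)) (proj₂ (cfPair L))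
cf-pair L with cfPair L
... | p , q = refl

cf-∷-pair : ∀ c L → cf (c ∷ L) ≡ mkℚᵘ (+ suc (proj₂ (cfPair L))) (ℕ.pred (c ℕ.* suc (proj₂ (cfPair L)) ℕ.+ proj₁ (cfPair L)))
cf-∷-pair c L with cfPair L
... | p , q = refl

cf-nonNeg : ∀ L → 0ℚᵘ ≤ cf L
cf-nonNeg L rewrite cf-pair L = mkℚᵘ-≤ ℕ.z≤n

cf-∷-pos : ∀ c L → 0ℚᵘ < cf (suc c ∷ L)
cf-∷-pos c L rewrite cf-∷-pair (suc c) L = mkℚᵘ-< (ℕ.s≤s ℕ.z≤n)

cf-∷-recursion : ∀ c L → cf (suc c ∷ L) * (⟦ suc c ⟧ + cf L) ≃ 1ℚᵘ
cf-∷-recursion c L rewrite cf-∷-pair (suc c) L | cf-pair L = recursion (proj₁ (cfPair L)) (proj₂ (cfPair L))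
  where
  identity : ∀ c p q → suc q ℕ.* (suc c ℕ.* suc q ℕ.+ p ℕ.* 1) ℕ.* 1
                     ≡ 1 ℕ.* suc ((q ℕ.+ 0 ℕ.* suc q) ℕ.+ (q ℕ.+ c ℕ.* suc q ℕ.+ p) ℕ.* suc (q ℕ.+ 0 ℕ.* suc q))
  identity = ℕSolver.solve-∀
  recursion : ∀ p q → mkℚᵘ (+ suc q) (ℕ.pred (suc c ℕ.* suc q ℕ.+ p)) * (⟦ suc c ⟧ + mkℚᵘ (+ p) q) ≃ 1ℚᵘ
  recursion p q = QP.≃-trans
    (QP.≃-reflexive (trans (cong (x *_) (+-mkℚᵘ (suc c) 0 p q))
      (*-mkℚᵘ (suc q) (ℕ.pred (suc c ℕ.* suc q ℕ.+ p)) (suc c ℕ.* suc q ℕ.+ p ℕ.* 1) (q ℕ.+ 0 ℕ.* suc q))))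
    (mkℚᵘ-≃ (identity c p q))
    where x = mkℚᵘ (+ suc q) (ℕ.pred (suc c ℕ.* suc q ℕ.+ p))

cfPair-∷ : ∀ c L → cfPair (c ∷ L) ≡ (suc (proj₂ (cfPair L)) , ℕ.pred (c ℕ.* suc (proj₂ (cfPair L)) ℕ.+ proj₁ (cfPair L)))
cfPair-∷ c L with cfPair L
... | p , q = refl

cf-2∷+cf-1∷1∷ : ∀ L → cf (2 ∷ L) + cf (1 ∷ 1 ∷ L) ≃ 1ℚᵘ
cf-2∷+cf-1∷1∷ L rewrite cf-∷-pair 2 L | cf-∷-pair 1 (1 ∷ L) | cfPair-∷ 1 L =
  QP.≃-trans (QP.≃-reflexive (+-mkℚᵘ (suc q) (q ℕ.+ (suc q ℕ.+ 0) ℕ.+ p) (suc (q ℕ.+ 0 ℕ.+ p)) ((q ℕ.+ 0 ℕ.+ p) ℕ.+ 0 ℕ.+ suc q)))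
             (mkℚᵘ-≃ (identity p q))
  where
  p = proj₁ (cfPair L)
  q = proj₂ (cfPair L)
  identity : ∀ p q → (suc q ℕ.* suc ((q ℕ.+ 0 ℕ.+ p) ℕ.+ 0 ℕ.+ suc q) ℕ.+ suc (q ℕ.+ 0 ℕ.+ p) ℕ.* suc (q ℕ.+ (suc q ℕ.+ 0) ℕ.+ p)) ℕ.* 1
         ≡ 1 ℕ.* suc (((q ℕ.+ 0 ℕ.+ p) ℕ.+ 0 ℕ.+ suc q) ℕ.+ (q ℕ.+ (suc q ℕ.+ 0) ℕ.+ p) ℕ.* suc ((q ℕ.+ 0 ℕ.+ p) ℕ.+ 0 ℕ.+ suc q))
  identity = ℕSolver.solve-∀

reciprocal-antitone : ∀ {x s y t} → 0ℚᵘ ≤ x → 0ℚᵘ ≤ y → x * s ≃ 1ℚᵘ → y * t ≃ 1ℚᵘ → s ≤ t → y ≤ x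
reciprocal-antitone {x} {s} {y} {t} x≥0 y≥0 xs≃1 yt≃1 s≤t = begin
  y             ≃⟨ QP.≃-sym (QP.*-identityʳ y) ⟩
  y * 1ℚᵘ       ≃⟨ QP.*-congˡ {y} (QP.≃-sym xs≃1) ⟩
  y * (x * s)   ≃⟨ swap y x s ⟩
  x * (y * s)   ≤⟨ QP.*-monoʳ-≤-nonNeg x {{Q.nonNegative x≥0}} (QP.*-monoʳ-≤-nonNeg y {{Q.nonNegative y≥0}} s≤t) ⟩
  x * (y * t)   ≃⟨ QP.*-congˡ {x} yt≃1 ⟩
  x * 1ℚᵘ       ≃⟨ QP.*-identityʳ x ⟩
  x             ∎
  where
  open QP.≤-Reasoning
  swap : ∀ y x s → y * (x * s) ≃ x * (y * s)
  swap = solve-∀ ℚᵘ-ring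

cf-∷-≤ : ∀ c L x s → 0ℚᵘ ≤ x → x * s ≃ 1ℚᵘ → s ≤ ⟦ suc c ⟧ + cf L → cf (suc c ∷ L) ≤ x
cf-∷-≤ c L x s x≥0 xs≃1 = reciprocal-antitone x≥0 (QP.<⇒≤ (cf-∷-pos c L)) xs≃1 (cf-∷-recursion c L)

cf-∷-≥ : ∀ c L x s → 0ℚᵘ ≤ x → x * s ≃ 1ℚᵘ → ⟦ suc c ⟧ + cf L ≤ s → x ≤ cf (suc c ∷ L)
cf-∷-≥ c L x s x≥0 xs≃1 = reciprocal-antitone (QP.<⇒≤ (cf-∷-pos c L)) x≥0 (cf-∷-recursion c L) xs≃1

cf-∷-≤1 : ∀ c L → cf (suc c ∷ L) ≤ 1ℚᵘ
cf-∷-≤1 c L = cf-∷-≤ c L 1ℚᵘ 1ℚᵘ (mkℚᵘ-≤ ℕ.z≤n) (*≡* refl)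
  (QP.≤-trans (mkℚᵘ-≤ (ℕ.s≤s ℕ.z≤n)) (QP.p≤p+q ⟦ suc c ⟧ (cf L) {{Q.nonNegative (cf-nonNeg L)}}))

cf-≤1 : ∀ {L} → Digits L → cf L ≤ 1ℚᵘ
cf-≤1 [] = mkℚᵘ-≤ ℕ.z≤n
cf-≤1 {L = _ ∷ L} (inj₁ refl ∷ _) = cf-∷-≤1 0 L
cf-≤1 {L = _ ∷ L} (inj₂ refl ∷ _) = cf-∷-≤1 1 L

cf-2∷-≤½ : ∀ L → cf (2 ∷ L) ≤ ½
cf-2∷-≤½ L = cf-∷-≤ 1 L ½ ⟦ 2 ⟧ (mkℚᵘ-≤ ℕ.z≤n) (*≡* refl) (QP.p≤p+q ⟦ 2 ⟧ (cf L) {{Q.nonNegative (cf-nonNeg L)}})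

cf-1∷-≥½ : ∀ {L} → Digits L → ½ ≤ cf (1 ∷ L)
cf-1∷-≥½ {L} ds = cf-∷-≥ 0 L ½ ⟦ 2 ⟧ (mkℚᵘ-≤ ℕ.z≤n) (*≡* refl) (QP.+-monoʳ-≤ ⟦ 1 ⟧ (cf-≤1 ds))

cf-∷-≥⅓ : ∀ {c L} → Digit c → Digits L → ⅓ ≤ cf (c ∷ L)
cf-∷-≥⅓ {L = L} (inj₁ refl) ds = cf-∷-≥ 0 L ⅓ ⟦ 3 ⟧ (mkℚᵘ-≤ ℕ.z≤n) (*≡* refl)
  (QP.≤-trans (QP.+-monoʳ-≤ ⟦ 1 ⟧ (cf-≤1 ds)) (mkℚᵘ-≤ (ℕ.s≤s (ℕ.s≤s ℕ.z≤n))))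
cf-∷-≥⅓ {L = L} (inj₂ refl) ds = cf-∷-≥ 1 L ⅓ ⟦ 3 ⟧ (mkℚᵘ-≤ ℕ.z≤n) (*≡* refl)
  (QP.+-monoʳ-≤ ⟦ 2 ⟧ (cf-≤1 ds))

cf-∷-≤¾ : ∀ c L → ⅓ ≤ cf L → cf (suc c ∷ L) ≤ ¾
cf-∷-≤¾ c L ⅓≤ = cf-∷-≤ c L ¾ (mkℚᵘ (+ 4) 2) (mkℚᵘ-≤ ℕ.z≤n) (*≡* refl)
  (QP.+-mono-≤ (mkℚᵘ-≤ {1} {0} {suc c} {0} (ℕ.s≤s ℕ.z≤n)) ⅓≤)

cf-∷-difference : ∀ c X Y →
  cf (suc c ∷ X) - cf (suc c ∷ Y) ≃ (cf Y - cf X) * (cf (suc c ∷ X) * cf (suc c ∷ Y))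
cf-∷-difference c X Y = begin-equality
  w - w'
    ≃⟨ QP.+-cong (QP.≃-sym (unit w (cf-∷-recursion c Y))) (QP.-‿cong (QP.≃-sym (unit w' (cf-∷-recursion c X)))) ⟩
  w * (w' * (γ + v')) - w' * (w * (γ + v))
    ≃⟨ expand w w' γ v v' ⟩
  (v' - v) * (w * w')
    ∎
  where
  open QP.≤-Reasoning
  w = cf (suc c ∷ X)
  w' = cf (suc c ∷ Y)
  v = cf X
  v' = cf Y
  γ = ⟦ suc c ⟧
  unit : ∀ x {y} → y ≃ 1ℚᵘ → x * y ≃ x
  unit x y≃1 = QP.≃-trans (QP.*-congˡ {x} y≃1) (QP.*-identityʳ x)
  expand : ∀ w w' γ v v' → w * (w' * (γ + v')) - w' * (w * (γ + v)) ≃ (v' - v) * (w * w')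
  expand = solve-∀ ℚᵘ-ring

cf-∷-antitone : ∀ c X Y → cf X ≤ cf Y → cf (suc c ∷ Y) ≤ cf (suc c ∷ X)
cf-∷-antitone c X Y X≤Y =
  ≤-by (0≤* (QP.p≤q⇒0≤q-p X≤Y) (0≤* (QP.<⇒≤ (cf-∷-pos c X)) (QP.<⇒≤ (cf-∷-pos c Y)))) (cf-∷-difference c X Y)

cf-∷-strictlyAntitone : ∀ c X Y → cf X < cf Y → cf (suc c ∷ Y) < cf (suc c ∷ X)
cf-∷-strictlyAntitone c X Y X<Y =
  <-by (0<* (p<q⇒0<q-p X<Y) (0<* (cf-∷-pos c X) (cf-∷-pos c Y))) (cf-∷-difference c X Y)

cf-∷-contraction : ∀ c X Y {k} → cf (suc c ∷ X) * cf (suc c ∷ Y) ≤ k →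
  ∣ cf (suc c ∷ X) - cf (suc c ∷ Y) ∣ ≤ ∣ cf X - cf Y ∣ * k
cf-∷-contraction c X Y {k} ww'≤k = begin
  ∣ cf (suc c ∷ X) - cf (suc c ∷ Y) ∣          ≃⟨ QP.∣-∣-cong (cf-∷-difference c X Y) ⟩
  ∣ (cf Y - cf X) * (w * w') ∣                 ≃⟨ QP.∣p*q∣≃∣p∣*∣q∣ (cf Y - cf X) (w * w') ⟩
  ∣ cf Y - cf X ∣ * ∣ w * w' ∣                 ≃⟨ QP.*-cong (∣p-q∣-comm (cf Y) (cf X)) (QP.0≤p⇒∣p∣≃p ww'≥0) ⟩
  ∣ cf X - cf Y ∣ * (w * w')                   ≤⟨ QP.*-monoʳ-≤-nonNeg ∣ cf X - cf Y ∣ {{Q.nonNegative (QP.0≤∣p∣ (cf X - cf Y))}} ww'≤k ⟩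
  ∣ cf X - cf Y ∣ * k                          ∎
  where
  open QP.≤-Reasoning
  w = cf (suc c ∷ X)
  w' = cf (suc c ∷ Y)
  ww'≥0 : 0ℚᵘ ≤ w * w'
  ww'≥0 = 0≤* (QP.<⇒≤ (cf-∷-pos c X)) (QP.<⇒≤ (cf-∷-pos c Y))

-- Order along common prefixes

OrderPreserving : List ℕ → Set
OrderPreserving P =
  (∀ X Y → cf X ≤ cf Y → cf (P ++ X) ≤ cf (P ++ Y)) × (∀ X Y → cf X < cf Y → cf (P ++ X) < cf (P ++ Y))

OrderReversing : List ℕ → Set
OrderReversing P =
  (∀ X Y → cf X ≤ cf Y → cf (P ++ Y) ≤ cf (P ++ X)) × (∀ X Y → cf X < cf Y → cf (P ++ Y) < cf (P ++ X))

[]-preserving : OrderPreserving []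
[]-preserving = (λ _ _ X≤Y → X≤Y) , (λ _ _ X<Y → X<Y)

∷-reversing : ∀ c P → OrderPreserving P → OrderReversing (suc c ∷ P)
∷-reversing c P (mono , strict) =
  (λ X Y X≤Y → cf-∷-antitone c (P ++ X) (P ++ Y) (mono X Y X≤Y)) ,
  (λ X Y X<Y → cf-∷-strictlyAntitone c (P ++ X) (P ++ Y) (strict X Y X<Y))

∷-preserving : ∀ c P → OrderReversing P → OrderPreserving (suc c ∷ P)
∷-preserving c P (anti , strict) =
  (λ X Y X≤Y → cf-∷-antitone c (P ++ Y) (P ++ X) (anti X Y X≤Y)) ,
  (λ X Y X<Y → cf-∷-strictlyAntitone c (P ++ Y) (P ++ X) (strict X Y X<Y))

ones-preserving : ∀ m → OrderPreserving (replicate (2 ℕ.* m) 1)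
ones-preserving zero = []-preserving
ones-preserving (suc m) =
  subst (λ n → OrderPreserving (replicate n 1)) (sym (ℕP.*-suc 2 m))
    (∷-preserving 0 (1 ∷ replicate (2 ℕ.* m) 1) (∷-reversing 0 (replicate (2 ℕ.* m) 1) (ones-preserving m)))

even-ones-preserving : ∀ {k} → Even k → OrderPreserving (replicate k 1)
even-ones-preserving (m , refl) = ones-preserving m

odd-ones-reversing : ∀ {k} → Odd k → OrderReversing (replicate k 1)
odd-ones-reversing (m , refl) = ∷-reversing 0 (replicate (2 ℕ.* m) 1) (ones-preserving m)

cf-2∷∷-≤ : ∀ {z Z} → Digit z → Digits Z → cf (2 ∷ z ∷ Z) ≤ cf (2 ∷ 3 ∷ [])
cf-2∷∷-≤ {z} {Z} dz dZ = cf-∷-antitone 1 (3 ∷ []) (z ∷ Z) (cf-∷-≥⅓ dz dZ)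

cf-2∷3∷<cf-1∷1∷ : cf (2 ∷ 3 ∷ []) < cf (1 ∷ 1 ∷ [])
cf-2∷3∷<cf-1∷1∷ = mkℚᵘ-< (ℕP.n<1+n 6)

cf-1∷-≥ : ∀ {t} → Digits t → cf (1 ∷ 1 ∷ []) ≤ cf (1 ∷ t)
cf-1∷-≥ {t} dt = cf-∷-antitone 0 t (1 ∷ []) (cf-≤1 dt)

+-gap : ∀ {x lo hi y} → x ≤ lo → hi ≤ y → x + (hi - lo) ≤ y
+-gap {x} {lo} {hi} {y} x≤lo hi≤y = ≤-by (0≤+ (QP.p≤q⇒0≤q-p hi≤y) (QP.p≤q⇒0≤q-p x≤lo)) (rearrange x lo hi y)
  where
  rearrange : ∀ x lo hi y → y - (x + (hi - lo)) ≃ (y - hi) + (lo - x)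
  rearrange = solve-∀ ℚᵘ-ring

separation-preserving : ∀ P → OrderPreserving P → ∃[ g ] 0ℚᵘ < g ×
  (∀ {t z Z} → Digits t → Digit z → Digits Z → cf (P ++ 2 ∷ z ∷ Z) + g ≤ cf (P ++ 1 ∷ t))
separation-preserving P (mono , strict) =
  cf (P ++ 1 ∷ 1 ∷ []) - cf (P ++ 2 ∷ 3 ∷ []) ,
  p<q⇒0<q-p (strict _ _ cf-2∷3∷<cf-1∷1∷) ,
  λ dt dz dZ → +-gap (mono _ _ (cf-2∷∷-≤ dz dZ)) (mono _ _ (cf-1∷-≥ dt))

separation-reversing : ∀ P → OrderReversing P → ∃[ g ] 0ℚᵘ < g ×
  (∀ {t z Z} → Digits t → Digit z → Digits Z → cf (P ++ 1 ∷ t) + g ≤ cf (P ++ 2 ∷ z ∷ Z))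
separation-reversing P (anti , strict) =
  cf (P ++ 2 ∷ 3 ∷ []) - cf (P ++ 1 ∷ 1 ∷ []) ,
  p<q⇒0<q-p (strict _ _ cf-2∷3∷<cf-1∷1∷) ,
  λ dt dz dZ → +-gap (anti _ _ (cf-1∷-≥ dt)) (anti _ _ (cf-2∷∷-≤ dz dZ))

-- Cylinders

width : ℕ → ℚᵘ
width m = mkℚᵘ (+ 3) (suc (suc m))

width-step : ∀ m → width m * ¾ ≤ width (suc m)
width-step m = mkℚᵘ-≤ (begin
  9 ℕ.* suc (suc (suc (suc m)))                    ≤⟨ ℕP.m≤m+n _ (3 ℕ.* m) ⟩
  9 ℕ.* suc (suc (suc (suc m))) ℕ.+ 3 ℕ.* m        ≡⟨ identity m ⟩
  3 ℕ.* suc (3 ℕ.+ suc (suc m) ℕ.* 4)              ∎)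
  where
  open ℕP.≤-Reasoning
  identity : ∀ m → 9 ℕ.* suc (suc (suc (suc m))) ℕ.+ 3 ℕ.* m ≡ 3 ℕ.* suc (3 ℕ.+ suc (suc m) ℕ.* 4)
  identity = ℕSolver.solve-∀

width-archimedean : ∀ {ε} → 0ℚᵘ < ε → ∃[ M ] (∀ m → M ℕ.≤ m → width m ≤ ε)
width-archimedean {mkℚᵘ +[1+ a ] d} _ = 3 ℕ.* suc d , λ m M≤m → mkℚᵘ-≤ (begin
  3 ℕ.* suc d                    ≤⟨ M≤m ⟩
  m                              ≤⟨ ℕP.m≤n+m m 3 ⟩
  3 ℕ.+ m                        ≤⟨ ℕP.m≤n*m (3 ℕ.+ m) (suc a) ⟩
  suc a ℕ.* (3 ℕ.+ m)            ∎)
  where open ℕP.≤-Reasoning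
width-archimedean {mkℚᵘ (+ 0) d} (*<* (ℤ.+<+ ()))
width-archimedean {mkℚᵘ -[1+ a ] d} (*<* ())

cf-++∷-≥⅓ : ∀ {Q z Z} → Digits Q → Digit z → Digits Z → ⅓ ≤ cf (Q ++ z ∷ Z)
cf-++∷-≥⅓ [] dz dZ = cf-∷-≥⅓ dz dZ
cf-++∷-≥⅓ (dc ∷ dQ) dz dZ = cf-∷-≥⅓ dc (All.++⁺ dQ (dz ∷ dZ))

cf-extension-distance : ∀ {Q z Z} → Digits Q → Digit z → Digits Z →
  ∣ cf Q - cf (Q ++ z ∷ Z) ∣ ≤ width (length Q)
cf-extension-distance {z = z} {Z} [] dz dZ = QP.≤-trans (QP.≤-reflexive ∣0-x∣≃x) (QP.≤-trans (cf-≤1 (dz ∷ dZ)) (mkℚᵘ-≤ ℕP.≤-refl))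
  where
  ∣0-x∣≃x : ∣ 0ℚᵘ - cf (z ∷ Z) ∣ ≃ cf (z ∷ Z)
  ∣0-x∣≃x = QP.≃-trans (QP.∣-∣-cong (QP.+-identityˡ (Q.- cf (z ∷ Z))))
            (QP.≃-trans (QP.∣-p∣≃∣p∣ (cf (z ∷ Z))) (QP.0≤p⇒∣p∣≃p (cf-nonNeg (z ∷ Z))))
cf-extension-distance {c ∷ Q} {z} {Z} (dc ∷ dQ) dz dZ with digit-suc dc
... | c' , refl = begin
  ∣ cf (suc c' ∷ Q) - cf (suc c' ∷ Q ++ z ∷ Z) ∣     ≤⟨ cf-∷-contraction c' Q (Q ++ z ∷ Z) ww'≤¾ ⟩
  ∣ cf Q - cf (Q ++ z ∷ Z) ∣ * ¾                    ≤⟨ QP.*-monoˡ-≤-nonNeg ¾ (cf-extension-distance dQ dz dZ) ⟩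
  width (length Q) * ¾                              ≤⟨ width-step (length Q) ⟩
  width (suc (length Q))                            ∎
  where
  open QP.≤-Reasoning
  ww'≤¾ : cf (suc c' ∷ Q) * cf (suc c' ∷ Q ++ z ∷ Z) ≤ ¾
  ww'≤¾ = QP.≤-trans
    (*-mono-≤-nonNeg (QP.<⇒≤ (cf-∷-pos c' Q)) (QP.<⇒≤ (cf-∷-pos c' (Q ++ z ∷ Z)))
      (cf-∷-≤1 c' Q) (cf-∷-≤¾ c' (Q ++ z ∷ Z) (cf-++∷-≥⅓ dQ dz dZ)))
    (QP.≤-reflexive (QP.*-identityˡ ¾))

cf-prefix-nonexpanding : ∀ {P} → Digits P → ∀ X Y → ∣ cf (P ++ X) - cf (P ++ Y) ∣ ≤ ∣ cf X - cf Y ∣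
cf-prefix-nonexpanding [] X Y = QP.≤-refl
cf-prefix-nonexpanding {c ∷ P} (dc ∷ dP) X Y with digit-suc dc
... | c' , refl = begin
  ∣ cf (suc c' ∷ P ++ X) - cf (suc c' ∷ P ++ Y) ∣   ≤⟨ cf-∷-contraction c' (P ++ X) (P ++ Y) ww'≤1 ⟩
  ∣ cf (P ++ X) - cf (P ++ Y) ∣ * 1ℚᵘ             ≃⟨ QP.*-identityʳ _ ⟩
  ∣ cf (P ++ X) - cf (P ++ Y) ∣                   ≤⟨ cf-prefix-nonexpanding dP X Y ⟩
  ∣ cf X - cf Y ∣                                 ∎
  where
  open QP.≤-Reasoning
  ww'≤1 : cf (suc c' ∷ P ++ X) * cf (suc c' ∷ P ++ Y) ≤ 1ℚᵘ
  ww'≤1 = *-mono-≤-nonNeg (QP.<⇒≤ (cf-∷-pos c' (P ++ X))) (QP.<⇒≤ (cf-∷-pos c' (P ++ Y)))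
            (cf-∷-≤1 c' (P ++ X)) (cf-∷-≤1 c' (P ++ Y))

cf-2∷-contraction : ∀ X Y → ∣ cf (2 ∷ X) - cf (2 ∷ Y) ∣ ≤ ∣ cf X - cf Y ∣ * ¼
cf-2∷-contraction X Y = cf-∷-contraction 1 X Y
  (*-mono-≤-nonNeg (QP.<⇒≤ (cf-∷-pos 1 X)) (QP.<⇒≤ (cf-∷-pos 1 Y)) (cf-2∷-≤½ X) (cf-2∷-≤½ Y))

cf-1∷1∷-expansion : ∀ {X Y} → Digits X → Digits Y → cf Y ≤ cf X →
  ((cf X - cf Y) * ¼) * ¼ ≤ cf (1 ∷ 1 ∷ X) - cf (1 ∷ 1 ∷ Y)
cf-1∷1∷-expansion {X} {Y} dX dY Y≤X = begin
  ((cf X - cf Y) * ¼) * ¼                     ≤⟨ *-mono-≤-nonNeg (0≤* d≥0 ¼≥0) ¼≥0 (QP.*-monoʳ-≤-nonNeg (cf X - cf Y) {{Q.nonNegative d≥0}} uu'≥¼) ww'≥¼ ⟩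
  ((cf X - cf Y) * (u' * u)) * (w * w')       ≃⟨ QP.*-congʳ (QP.≃-sym (cf-∷-difference 0 Y X)) ⟩
  (u' - u) * (w * w')                         ≃⟨ QP.≃-sym (cf-∷-difference 0 (1 ∷ X) (1 ∷ Y)) ⟩
  cf (1 ∷ 1 ∷ X) - cf (1 ∷ 1 ∷ Y)             ∎
  where
  open QP.≤-Reasoning
  u = cf (1 ∷ X)
  u' = cf (1 ∷ Y)
  w = cf (1 ∷ 1 ∷ X)
  w' = cf (1 ∷ 1 ∷ Y)
  ¼≥0 : 0ℚᵘ ≤ ¼
  ¼≥0 = mkℚᵘ-≤ ℕ.z≤n
  d≥0 : 0ℚᵘ ≤ cf X - cf Y
  d≥0 = QP.p≤q⇒0≤q-p Y≤X
  ½≥0 : 0ℚᵘ ≤ ½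
  ½≥0 = mkℚᵘ-≤ ℕ.z≤n
  uu'≥¼ : ¼ ≤ u' * u
  uu'≥¼ = *-mono-≤-nonNeg ½≥0 ½≥0 (cf-1∷-≥½ dY) (cf-1∷-≥½ dX)
  ww'≥¼ : ¼ ≤ w * w'
  ww'≥¼ = *-mono-≤-nonNeg ½≥0 ½≥0 (cf-1∷-≥½ (inj₁ refl ∷ dX)) (cf-1∷-≥½ (inj₁ refl ∷ dY))

cf-ones-2-2-contraction : ∀ k X Y → Digits Y →
  ∣ cf (replicate (suc k) 1 ++ 2 ∷ 2 ∷ X) - cf (replicate (suc k) 1 ++ 2 ∷ 2 ∷ Y) ∣ ≤ ((∣ cf X - cf Y ∣ * ¼) * ¼) * ¾
cf-ones-2-2-contraction k X Y dY = begin
  ∣ cf (1 ∷ R ++ 2 ∷ 2 ∷ X) - cf (1 ∷ R ++ 2 ∷ 2 ∷ Y) ∣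
    ≤⟨ cf-∷-contraction 0 (R ++ 2 ∷ 2 ∷ X) (R ++ 2 ∷ 2 ∷ Y) ww'≤¾ ⟩
  ∣ cf (R ++ 2 ∷ 2 ∷ X) - cf (R ++ 2 ∷ 2 ∷ Y) ∣ * ¾
    ≤⟨ QP.*-monoˡ-≤-nonNeg ¾ (cf-prefix-nonexpanding (ones-digits k) (2 ∷ 2 ∷ X) (2 ∷ 2 ∷ Y)) ⟩
  ∣ cf (2 ∷ 2 ∷ X) - cf (2 ∷ 2 ∷ Y) ∣ * ¾
    ≤⟨ QP.*-monoˡ-≤-nonNeg ¾ (cf-2∷-contraction (2 ∷ X) (2 ∷ Y)) ⟩
  (∣ cf (2 ∷ X) - cf (2 ∷ Y) ∣ * ¼) * ¾
    ≤⟨ QP.*-monoˡ-≤-nonNeg ¾ (QP.*-monoˡ-≤-nonNeg ¼ (cf-2∷-contraction X Y)) ⟩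
  ((∣ cf X - cf Y ∣ * ¼) * ¼) * ¾
    ∎
  where
  open QP.≤-Reasoning
  R = replicate k 1
  ww'≤¾ : cf (1 ∷ R ++ 2 ∷ 2 ∷ X) * cf (1 ∷ R ++ 2 ∷ 2 ∷ Y) ≤ ¾
  ww'≤¾ = QP.≤-trans
    (*-mono-≤-nonNeg (QP.<⇒≤ (cf-∷-pos 0 (R ++ 2 ∷ 2 ∷ X))) (QP.<⇒≤ (cf-∷-pos 0 (R ++ 2 ∷ 2 ∷ Y)))
      (cf-∷-≤1 0 (R ++ 2 ∷ 2 ∷ X)) (cf-∷-≤¾ 0 (R ++ 2 ∷ 2 ∷ Y) (cf-++∷-≥⅓ (ones-digits k) (inj₂ refl) (inj₂ refl ∷ dY))))
    (QP.≤-reflexive (QP.*-identityˡ ¾))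

-- Since [0; 2, L] = 1 − [0; 1, 1, L], up to truncation errors A − B = Ψ k Lα − Ψ k Lβ, where
-- B = 2 + [0; 2, Lα] + [0; 1ᵏ⁺¹, 2, 2, …] and A = 2 + [0; 1ᵏ⁺¹, 2, 2, …] + [0; 2, Lβ].
Ψ : ℕ → List ℕ → ℚᵘ
Ψ k L = cf (replicate (suc k) 1 ++ 2 ∷ 2 ∷ L) + cf (1 ∷ 1 ∷ L)

-- The first term of Ψ moves by at most 3/4 of what the second one does.
Ψ-increasing : ∀ k X Y → Digits X → Digits Y → cf Y ≤ cf X →
  (((cf X - cf Y) * ¼) * ¼) * ¼ ≤ Ψ k X - Ψ k Y
Ψ-increasing k X Y dX dY Y≤X =
  ≤-by (0≤+ (QP.p≤q⇒0≤q-p FY≤FX+D¾) (QP.p≤q⇒0≤q-p (cf-1∷1∷-expansion dX dY Y≤X)))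
       (QP.≃-trans (QP.+-congʳ (Ψ k X - Ψ k Y) (QP.-‿cong D¼≃D-D¾))
                   (rearrange (F X) (F Y) (cf (1 ∷ 1 ∷ X)) (cf (1 ∷ 1 ∷ Y)) D (D * ¾)))
  where
  F : List ℕ → ℚᵘ
  F L = cf (replicate (suc k) 1 ++ 2 ∷ 2 ∷ L)
  D = ((cf X - cf Y) * ¼) * ¼
  ∣F-F∣≤ : ∣ F X - F Y ∣ ≤ D * ¾
  ∣F-F∣≤ = QP.≤-trans (cf-ones-2-2-contraction k X Y dY)
    (QP.≤-reflexive (QP.*-congʳ {¾} (QP.*-congʳ {¼} (QP.*-congʳ {¼} (QP.0≤p⇒∣p∣≃p (QP.p≤q⇒0≤q-p Y≤X))))))
  FY≤FX+D¾ : F Y ≤ F X + D * ¾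
  FY≤FX+D¾ = ∣p-q∣≤⇒p≤q+ (F Y) (F X) {D * ¾} (QP.≤-respˡ-≃ (∣p-q∣-comm (F X) (F Y)) ∣F-F∣≤)
  D¼≃D-D¾ : D * ¼ ≃ D - D * ¾
  D¼≃D-D¾ = QP.≃-trans (QP.*-congˡ {D} ¼≃1-¾) (factor D ¾)
    where
    ¼≃1-¾ : ¼ ≃ 1ℚᵘ - ¾
    ¼≃1-¾ = *≡* refl
    factor : ∀ p q → p * (1ℚᵘ - q) ≃ p - p * q
    factor = solve-∀ ℚᵘ-ring
  rearrange : ∀ fx fy kx ky D a → (fx + kx) - (fy + ky) - (D - a) ≃ ((fx + a) - fy) + ((kx - ky) - D)
  rearrange = solve-∀ ℚᵘ-ring

-- Words of a digit sequence

word : (ℕ → ℕ) → ℕ → ℕ → List ℕ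
word s i zero = []
word s i (suc n) = s i ∷ word s (suc i) n

length-word : ∀ s i n → length (word s i n) ≡ n
length-word s i zero = refl
length-word s i (suc n) = cong suc (length-word s (suc i) n)

word-+ : ∀ s i m n → word s i (m ℕ.+ n) ≡ word s i m ++ word s (i ℕ.+ m) n
word-+ s i zero n = cong (λ j → word s j n) (sym (ℕP.+-identityʳ i))
word-+ s i (suc m) n = cong (s i ∷_) (trans (word-+ s (suc i) m n) (cong (λ j → word s (suc i) m ++ word s j n) (sym (ℕP.+-suc i m))))

word-constant : ∀ {s i c} r → (∀ m → m ℕ.< r → s (i ℕ.+ m) ≡ c) → word s i r ≡ replicate r c
word-constant {s} {i} zero _ = refl
word-constant {s} {i} (suc r) const = cong₂ _∷_
  (trans (cong s (sym (ℕP.+-identityʳ i))) (const 0 (ℕ.s≤s ℕ.z≤n)))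
  (word-constant r (λ m m<r → trans (cong s (sym (ℕP.+-suc i m))) (const (suc m) (ℕ.s≤s m<r))))

word-digits : ∀ {s} → (∀ j → Digit (s j)) → ∀ i n → Digits (word s i n)
word-digits digit i zero = []
word-digits digit i (suc n) = digit i ∷ word-digits digit (suc i) n

word-prefix : ∀ {s i m n P} → (∀ j → Digit (s j)) → word s i m ≡ P → m ℕ.≤ n → ∃[ t ] Digits t × word s i n ≡ P ++ t
word-prefix {s} {i} {m} {n} digit eq m≤n =
  word s (i ℕ.+ m) (n ℕ.∸ m) , word-digits digit _ _ ,
  trans (cong (word s i) (sym (ℕP.m+[n∸m]≡n m≤n))) (trans (word-+ s i m (n ℕ.∸ m)) (cong (_++ _) eq))

applyUpTo-word : ∀ f s i n → (∀ m → f m ≡ s (i ℕ.+ m)) → applyUpTo f n ≡ word s i n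
applyUpTo-word f s i zero _ = refl
applyUpTo-word f s i (suc n) f≗s = cong₂ _∷_
  (trans (f≗s 0) (cong s (ℕP.+-identityʳ i)))
  (applyUpTo-word (λ m → f (suc m)) s (suc i) n (λ m → trans (f≗s (suc m)) (cong s (ℕP.+-suc i m))))

ones-∷ : ∀ m t → 1 ∷ replicate m 1 ++ t ≡ replicate m 1 ++ 1 ∷ t
ones-∷ zero t = refl
ones-∷ (suc m) t = cong (1 ∷_) (ones-∷ m t)

record Pattern (k b : ℕ) (s : ℕ → ℕ) : Set where
  field
    digit : ∀ j → Digit (s j)
    centre : s 0 ≡ 2
    run₁ : ∀ m → m ℕ.< k → s (suc m) ≡ 1
    pair₁ : s (suc k) ≡ 2
    pair₂ : s (2 ℕ.+ k) ≡ 2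
    run₂ : ∀ m → m ℕ.< b → s (3 ℕ.+ k ℕ.+ m) ≡ 1
    end : s (3 ℕ.+ k ℕ.+ b) ≡ 2

module PatternWords {k b s} (P : Pattern k b s) where
  open Pattern P

  ones-22 : ∀ n → word s 1 (k ℕ.+ (2 ℕ.+ n)) ≡ replicate k 1 ++ 2 ∷ 2 ∷ word s (3 ℕ.+ k) n
  ones-22 n = trans (word-+ s 1 k (2 ℕ.+ n))
    (cong₂ _++_ (word-constant k run₁) (cong₂ _∷_ pair₁ (cong (_∷ word s (3 ℕ.+ k) n) pair₂)))

  head-shape : ∀ {n} → 2 ℕ.+ k ℕ.≤ n → ∃[ t ] Digits t × word s 1 n ≡ replicate k 1 ++ 2 ∷ 2 ∷ t
  head-shape {n} 2+k≤n =
    let t , dt , eq = word-prefix digit (ones-22 0) (subst (ℕ._≤ n) (ℕP.+-comm 2 k) 2+k≤n)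
    in t , dt , trans eq (List.++-assoc (replicate k 1) (2 ∷ 2 ∷ []) t)

  extension : ∀ n → word s 1 (suc n) ++ word s (2 ℕ.+ n) (suc k) ≡ replicate k 1 ++ 2 ∷ 2 ∷ word s (3 ℕ.+ k) n
  extension n = trans (sym (word-+ s 1 (suc n) (suc k))) (trans (cong (word s 1) (arith k n)) (ones-22 n))
    where
    arith : ∀ k n → suc n ℕ.+ suc k ≡ k ℕ.+ (2 ℕ.+ n)
    arith = ℕSolver.solve-∀

  head-truncation : ∀ n → ∣ cf (word s 1 (suc n)) - cf (replicate k 1 ++ 2 ∷ 2 ∷ word s (3 ℕ.+ k) n) ∣ ≤ width (suc n)
  head-truncation n = subst₂ (λ L m → ∣ cf (word s 1 (suc n)) - cf L ∣ ≤ width m)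
    (extension n) (length-word s 1 (suc n))
    (cf-extension-distance (word-digits digit 1 (suc n)) (digit _) (word-digits digit _ k))

  tail-ones : ∀ {m n} → m ℕ.< b → m ℕ.< n → ∃[ t ] Digits t × word s (3 ℕ.+ k) n ≡ replicate m 1 ++ 1 ∷ t
  tail-ones {m} m<b m<n =
    let t , dt , eq = word-prefix digit (word-constant (suc m) (λ j j≤m → run₂ j (ℕP.<-≤-trans j≤m m<b))) m<n
    in t , dt , trans eq (ones-∷ m t)

  tail-end : ∀ {n} → 2 ℕ.+ b ℕ.≤ n → ∃[ z ] ∃[ Z ] Digit z × Digits Z × word s (3 ℕ.+ k) n ≡ replicate b 1 ++ 2 ∷ z ∷ Z
  tail-end {n} 2+b≤n =
    let t , dt , eq = word-prefix digit ones-2-next (subst (ℕ._≤ n) (ℕP.+-comm 2 b) 2+b≤n)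
    in next , t , digit _ , dt , trans eq (List.++-assoc (replicate b 1) (2 ∷ next ∷ []) t)
    where
    next = s (suc (3 ℕ.+ k ℕ.+ b))
    ones-2-next : word s (3 ℕ.+ k) (b ℕ.+ 2) ≡ replicate b 1 ++ 2 ∷ next ∷ []
    ones-2-next = trans (word-+ s (3 ℕ.+ k) b 2) (cong₂ _++_ (word-constant b run₂) (cong (_∷ next ∷ []) end))

-- Truncated λ-values

approx : (ℕ → ℕ) → (ℕ → ℕ) → ℕ → ℕ → RSeq
approx s s' i j n = (⟦ 2 ⟧ + cf (word s i n)) + cf (word s' j n)

approx-swap : ∀ s s' i j n → approx s s' i j n ≡ approx s' s j i n
approx-swap s s' i j n = trans (QP.+-assoc-≡ ⟦ 2 ⟧ (cf (word s i n)) (cf (word s' j n)))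
  (trans (cong (λ x → ⟦ 2 ⟧ + x) (QP.+-comm-≡ (cf (word s i n)) (cf (word s' j n))))
         (sym (QP.+-assoc-≡ ⟦ 2 ⟧ (cf (word s' j n)) (cf (word s i n)))))

<ᵣ-transport : ∀ {x y} x' y' → (∀ n → x' n ≡ x n) → (∀ n → y' n ≡ y n) → x <ᵣ y → x' <ᵣ y'
<ᵣ-transport x' y' x'≡x y'≡y (ε , ε>0 , N , bound) =
  ε , ε>0 , N , λ n N≤n → subst₂ (λ a b → a + ε ≤ b) (sym (x'≡x n)) (sym (y'≡y n)) (bound n N≤n)

drop-gap : ∀ {x g y} → 0ℚᵘ < g → x + g ≤ y → x ≤ y
drop-gap {x} {g} {y} g>0 x+g≤y = QP.≤-trans (QP.p≤p+q x g {{Q.nonNegative (QP.<⇒≤ g>0)}}) x+g≤y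

sides-gap : ∀ {c x x' y y' g} → x + g ≤ y' → x' ≤ y → ((c + x) + x') + g ≤ (c + y) + y'
sides-gap {c} {x} {x'} {y} {y'} {g} x+g≤y' x'≤y =
  ≤-by (0≤+ (QP.p≤q⇒0≤q-p x+g≤y') (QP.p≤q⇒0≤q-p x'≤y)) (rearrange c x x' y y' g)
  where
  rearrange : ∀ c x x' y y' g → ((c + y) + y') - (((c + x) + x') + g) ≃ (y' - (x + g)) + (y - x')
  rearrange = solve-∀ ℚᵘ-ring

three-gap : ∀ {x K y g} → x + K ≃ 1ℚᵘ → K + g ≤ y → ⟦ 3 ⟧ + g ≤ (⟦ 2 ⟧ + x) + y
three-gap {x} {K} {y} {g} x+K≃1 K+g≤y =
  ≤-by (0≤+ (0≤+ (QP.p≤q⇒0≤q-p K+g≤y) (QP.p≤q⇒0≤q-p (QP.≤-reflexive (QP.≃-sym x+K≃1))))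
            (QP.p≤q⇒0≤q-p (QP.≤-reflexive 3≃2+1)))
       (rearrange ⟦ 2 ⟧ ⟦ 3 ⟧ x K y g)
  where
  3≃2+1 : ⟦ 3 ⟧ ≃ ⟦ 2 ⟧ + 1ℚᵘ
  3≃2+1 = *≡* refl
  rearrange : ∀ two three x K y g → ((two + x) + y) - (three + g) ≃ ((y - (K + g)) + ((x + K) - 1ℚᵘ)) + ((two + 1ℚᵘ) - three)
  rearrange = solve-∀ ℚᵘ-ring

module _ {k a b s s'} (right : Pattern k b s) (left : Pattern k a s') (k-odd : Odd k) (k<b : k ℕ.< b) where
  private
    module R = PatternWords right
    module L = PatternWords left
    k<n : ∀ {n} → 2 ℕ.+ k ℕ.≤ n → k ℕ.< n
    k<n = ℕP.≤-trans (ℕP.n≤1+n (suc k))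

  approx-C<B : approx s s' (3 ℕ.+ k) 0 <ᵣ approx s s' (2 ℕ.+ k) 1
  approx-C<B =
    let g , g>0 , gap = separation-reversing (replicate k 1) (odd-ones-reversing k-odd)
        g' , g'>0 , gap' = separation-preserving (2 ∷ replicate k 1) (∷-preserving 1 (replicate k 1) (odd-ones-reversing k-odd))
        bound : ∀ n → 3 ℕ.+ k ℕ.≤ n → approx s s' (3 ℕ.+ k) 0 n + g ≤ approx s s' (2 ℕ.+ k) 1 n
        bound = λ where
          (suc n) (ℕ.s≤s 2+k≤n) →
            let t₁ , dt₁ , Cf≡ = R.tail-ones k<b (ℕP.m<n⇒m<1+n (k<n 2+k≤n))
                t₂ , dt₂ , Bb≡ = L.head-shape {suc n} (ℕP.m≤n⇒m≤1+n 2+k≤n)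
                t₃ , dt₃ , Bf≡ = R.tail-ones k<b (k<n 2+k≤n)
                t₄ , dt₄ , Cb≡ = L.head-shape 2+k≤n
            in sides-gap {⟦ 2 ⟧} {cf (word s (3 ℕ.+ k) (suc n))} {cf (word s' 0 (suc n))}
                         {cf (word s (2 ℕ.+ k) (suc n))} {cf (word s' 1 (suc n))} {g}
                 (subst₂ (λ X Y → cf X + g ≤ cf Y) (sym Cf≡) (sym Bb≡) (gap dt₁ (inj₂ refl) dt₂))
                 (subst₂ (λ X Y → cf X ≤ cf Y)
                   (sym (cong₂ _∷_ (Pattern.centre left) Cb≡)) (sym (cong₂ _∷_ (Pattern.pair₂ right) Bf≡))
                   (drop-gap g'>0 (gap' dt₃ (inj₂ refl) dt₄)))
    in g , g>0 , 3 ℕ.+ k , bound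

  approx-3<B : three <ᵣ approx s s' (2 ℕ.+ k) 1
  approx-3<B =
    let g , g>0 , gap = separation-reversing (replicate k 1) (odd-ones-reversing k-odd)
        bound : ∀ n → 3 ℕ.+ k ℕ.≤ n → ⟦ 3 ⟧ + g ≤ approx s s' (2 ℕ.+ k) 1 n
        bound = λ where
          (suc n) (ℕ.s≤s 2+k≤n) →
            let Lα = word s (3 ℕ.+ k) n
                t , dt , Lα≡ = R.tail-ones k<b (k<n 2+k≤n)
                t' , dt' , Bb≡ = L.head-shape {suc n} (ℕP.m≤n⇒m≤1+n 2+k≤n)
                11Lα≡ : 1 ∷ 1 ∷ Lα ≡ replicate k 1 ++ 1 ∷ 1 ∷ 1 ∷ t
                11Lα≡ = trans (cong (λ L → 1 ∷ 1 ∷ L) Lα≡) (trans (cong (1 ∷_) (ones-∷ k (1 ∷ t))) (ones-∷ k (1 ∷ 1 ∷ t)))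
            in subst (λ c → ⟦ 3 ⟧ + g ≤ (⟦ 2 ⟧ + cf (c ∷ Lα)) + cf (word s' 1 (suc n))) (sym (Pattern.pair₂ right))
                 (three-gap {cf (2 ∷ Lα)} {cf (1 ∷ 1 ∷ Lα)} {cf (word s' 1 (suc n))} {g} (cf-2∷+cf-1∷1∷ Lα)
                   (subst₂ (λ X Y → cf X + g ≤ cf Y) (sym 11Lα≡) (sym Bb≡) (gap (inj₁ refl ∷ inj₁ refl ∷ dt) (inj₂ refl) dt')))
    in g , g>0 , 3 ℕ.+ k , bound

approx-gap : ∀ {p P q Q x X y Y e ε δ} →
  P ≤ p + e → q ≤ Q + e → x + X ≃ 1ℚᵘ → y + Y ≃ 1ℚᵘ → δ ≤ (P + X) - (Q + Y) → e ≤ ε → (ε + ε) + ε ≤ δ →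
  ((⟦ 2 ⟧ + x) + q) + ε ≤ (⟦ 2 ⟧ + p) + y
approx-gap {p} {P} {q} {Q} {x} {X} {y} {Y} {e} {ε} {δ} P≤p+e q≤Q+e x+X≃1 y+Y≃1 δ≤ e≤ε 3ε≤δ =
  ≤-by (0≤+ (0≤+ (0≤+ (0≤+ (0≤+ (0≤+ (nonneg P≤p+e) (nonneg q≤Q+e)) (nonneg δ≤)) (nonneg 3ε≤δ)) (nonneg e≤ε)) (nonneg e≤ε))
             (nonneg (QP.≤-reflexive (QP.≃-trans x+X≃1 (QP.≃-sym y+Y≃1)))))
       (rearrange ⟦ 2 ⟧ p P q Q x X y Y e ε δ)
  where
  nonneg : ∀ {u v} → u ≤ v → 0ℚᵘ ≤ v - u
  nonneg = QP.p≤q⇒0≤q-p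
  rearrange : ∀ two p P q Q x X y Y e ε δ → ((two + p) + y) - (((two + x) + q) + ε) ≃
    ((((((((p + e) - P) + ((Q + e) - q)) + (((P + X) - (Q + Y)) - δ)) + (δ - ((ε + ε) + ε))) + (ε - e)) + (ε - e))
      + ((y + Y) - (x + X)))
  rearrange = solve-∀ ℚᵘ-ring

p+q≤r⇒q≤r-p : ∀ {a g b} → a + g ≤ b → g ≤ b - a
p+q≤r⇒q≤r-p {a} {g} {b} a+g≤b = ≤-by (QP.p≤q⇒0≤q-p a+g≤b) (rearrange a g b)
  where
  rearrange : ∀ a g b → (b - a) - g ≃ b - (a + g)
  rearrange = solve-∀ ℚᵘ-ring

p*¼+p*¼+p*¼≤p : ∀ {δ} → 0ℚᵘ ≤ δ → (δ * ¼ + δ * ¼) + δ * ¼ ≤ δ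
p*¼+p*¼+p*¼≤p {δ} δ≥0 = ≤-by (0≤* δ≥0 (mkℚᵘ-≤ ℕ.z≤n)) (QP.≃-trans (factor δ ¼) (QP.*-congˡ {δ} 1-¾≃¼))
  where
  factor : ∀ δ q → δ - ((δ * q + δ * q) + δ * q) ≃ δ * (1ℚᵘ - ((q + q) + q))
  factor = solve-∀ ℚᵘ-ring
  1-¾≃¼ : 1ℚᵘ - ((¼ + ¼) + ¼) ≃ ¼
  1-¾≃¼ = *≡* refl

approx-B<A : ∀ {k a b s s'} → Pattern (suc k) b s → Pattern (suc k) a s' →
  (λ n → cf (word s' (4 ℕ.+ k) n)) <ᵣ (λ n → cf (word s (4 ℕ.+ k) n)) →
  approx s s' (3 ℕ.+ k) 1 <ᵣ approx s s' 1 (3 ℕ.+ k)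
approx-B<A {k} {a} {b} {s} {s'} right left (g , g>0 , N , Lβ+g≤Lα) = ε , ε>0 , suc (N ℕ.+ M) , bound
  where
  ¼>0 : 0ℚᵘ < ¼
  ¼>0 = mkℚᵘ-< (ℕ.s≤s ℕ.z≤n)
  δ = ((g * ¼) * ¼) * ¼
  ε = δ * ¼
  δ>0 : 0ℚᵘ < δ
  δ>0 = 0<* (0<* (0<* g>0 ¼>0) ¼>0) ¼>0
  ε>0 : 0ℚᵘ < ε
  ε>0 = 0<* δ>0 ¼>0
  M = proj₁ (width-archimedean ε>0)
  width≤ε = proj₂ (width-archimedean ε>0)
  bound : ∀ n → suc (N ℕ.+ M) ℕ.≤ n → approx s s' (3 ℕ.+ k) 1 n + ε ≤ approx s s' 1 (3 ℕ.+ k) n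
  bound (suc n) (ℕ.s≤s N+M≤n) =
    subst₂ (λ c c' → ((⟦ 2 ⟧ + cf (c ∷ Lα)) + cf wβ) + ε ≤ (⟦ 2 ⟧ + cf wα) + cf (c' ∷ Lβ))
      (sym (Pattern.pair₂ right)) (sym (Pattern.pair₂ left))
      (approx-gap {cf wα} {cf (F Lα)} {cf wβ} {cf (F Lβ)} {cf (2 ∷ Lα)} {cf (1 ∷ 1 ∷ Lα)} {cf (2 ∷ Lβ)} {cf (1 ∷ 1 ∷ Lβ)}
                  {width (suc n)} {ε} {δ}
        (∣p-q∣≤⇒p≤q+ (cf (F Lα)) (cf wα) (QP.≤-respˡ-≃ (∣p-q∣-comm (cf wα) (cf (F Lα))) (PatternWords.head-truncation right n)))
        (∣p-q∣≤⇒p≤q+ (cf wβ) (cf (F Lβ)) (PatternWords.head-truncation left n))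
        (cf-2∷+cf-1∷1∷ Lα) (cf-2∷+cf-1∷1∷ Lβ)
        (QP.≤-trans δ≤ (Ψ-increasing k Lα Lβ (word-digits (Pattern.digit right) _ n) (word-digits (Pattern.digit left) _ n)
                                      (drop-gap g>0 Lβ+g≤Lα′)))
        (width≤ε (suc n) (ℕP.m≤n⇒m≤1+n (ℕP.m+n≤o⇒n≤o N N+M≤n)))
        (p*¼+p*¼+p*¼≤p (QP.<⇒≤ δ>0)))
    where
    Lα = word s (4 ℕ.+ k) n
    Lβ = word s' (4 ℕ.+ k) n
    wα = word s 1 (suc n)
    wβ = word s' 1 (suc n)
    F : List ℕ → List ℕ
    F L = replicate (suc k) 1 ++ 2 ∷ 2 ∷ L
    Lβ+g≤Lα′ : cf Lβ + g ≤ cf Lα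
    Lβ+g≤Lα′ = Lβ+g≤Lα n (ℕP.m+n≤o⇒m≤o N N+M≤n)
    δ≤ : δ ≤ (((cf Lα - cf Lβ) * ¼) * ¼) * ¼
    δ≤ = QP.*-monoˡ-≤-nonNeg ¼ (QP.*-monoˡ-≤-nonNeg ¼ (QP.*-monoˡ-≤-nonNeg ¼ (p+q≤r⇒q≤r-p {cf Lβ} {g} {cf Lα} Lβ+g≤Lα′)))

module _ {k a b s s'} (right : Pattern k b s) (left : Pattern k a s') (b<a : b ℕ.< a) where
  private
    module R = PatternWords right
    module L = PatternWords left
    b<n : ∀ {n} → 2 ℕ.+ b ℕ.≤ n → b ℕ.< n
    b<n = ℕP.≤-trans (ℕP.n≤1+n (suc b))

  tails-reversed : Odd b → (λ n → cf (word s' (3 ℕ.+ k) n)) <ᵣ (λ n → cf (word s (3 ℕ.+ k) n))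
  tails-reversed b-odd =
    let g , g>0 , gap = separation-reversing (replicate b 1) (odd-ones-reversing b-odd)
        bound : ∀ n → 2 ℕ.+ b ℕ.≤ n → cf (word s' (3 ℕ.+ k) n) + g ≤ cf (word s (3 ℕ.+ k) n)
        bound n 2+b≤n =
          let t , dt , Lβ≡ = L.tail-ones b<a (b<n 2+b≤n)
              z , Z , dz , dZ , Lα≡ = R.tail-end 2+b≤n
          in subst₂ (λ X Y → cf X + g ≤ cf Y) (sym Lβ≡) (sym Lα≡) (gap dt dz dZ)
    in g , g>0 , 2 ℕ.+ b , bound

  tails-preserved : Even b → (λ n → cf (word s (3 ℕ.+ k) n)) <ᵣ (λ n → cf (word s' (3 ℕ.+ k) n))
  tails-preserved b-even =
    let g , g>0 , gap = separation-preserving (replicate b 1) (even-ones-preserving b-even)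
        bound : ∀ n → 2 ℕ.+ b ℕ.≤ n → cf (word s (3 ℕ.+ k) n) + g ≤ cf (word s' (3 ℕ.+ k) n)
        bound n 2+b≤n =
          let t , dt , Lβ≡ = L.tail-ones b<a (b<n 2+b≤n)
              z , Z , dz , dZ , Lα≡ = R.tail-end 2+b≤n
          in subst₂ (λ X Y → cf X + g ≤ cf Y) (sym Lα≡) (sym Lβ≡) (gap dt dz dZ)
    in g , g>0 , 2 ℕ.+ b , bound

parity-disjoint : ∀ {n} → Even n → Odd n → ⊥
parity-disjoint (m , n≡2m) (m' , n≡1+2m') = ℕP.even≢odd m m' (trans (sym n≡2m) n≡1+2m')

-- A, B, C, D of the paper: λ at positions 0, k + 2, k + 3 and −1 of ω.
λ-comparisons : ∀ {k a b s s'} {A B C D : RSeq} → Pattern (suc k) b s → Pattern (suc k) a s' →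
  Odd (suc k) → suc k ℕ.< b → suc k ℕ.< a →
  (∀ n → A n ≡ approx s s' 1 (3 ℕ.+ k) n) → (∀ n → B n ≡ approx s s' (3 ℕ.+ k) 1 n) →
  (∀ n → C n ≡ approx s s' (4 ℕ.+ k) 0 n) → (∀ n → D n ≡ approx s s' 0 (4 ℕ.+ k) n) →
  (((Even a × Odd b) ⊎ (Odd b × Odd a × b ℕ.< a)) → (B <ᵣ A) × (three <ᵣ B))
  × ((Even b × Even a × b ℕ.< a) → (A <ᵣ B) × (three <ᵣ A))
  × ((C <ᵣ B) × (D <ᵣ A))
λ-comparisons {k} {a} {b} {s} {s'} {A} {B} {C} {D} right left k-odd k<b k<a A≡ B≡ C≡ D≡ = part₁ , part₂ , part₃
  where
  mirrored : ∀ X i j → (∀ n → X n ≡ approx s s' i j n) → ∀ n → X n ≡ approx s' s j i n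
  mirrored X i j X≡ n = trans (X≡ n) (approx-swap s s' i j n)
  A≡ᵐ = mirrored A 1 (3 ℕ.+ k) A≡
  B≡ᵐ = mirrored B (3 ℕ.+ k) 1 B≡
  B<A : (λ n → cf (word s' (4 ℕ.+ k) n)) <ᵣ (λ n → cf (word s (4 ℕ.+ k) n)) → B <ᵣ A
  B<A tails = <ᵣ-transport B A B≡ A≡ (approx-B<A right left tails)
  3<B : three <ᵣ B
  3<B = <ᵣ-transport three B (λ _ → refl) B≡ (approx-3<B right left k-odd k<b)
  part₁ : ((Even a × Odd b) ⊎ (Odd b × Odd a × b ℕ.< a)) → (B <ᵣ A) × (three <ᵣ B)
  part₁ (inj₂ (b-odd , _ , b<a)) = B<A (tails-reversed right left b<a b-odd) , 3<B
  part₁ (inj₁ (a-even , b-odd)) with ℕP.<-cmp b a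
  ... | tri< b<a _ _ = B<A (tails-reversed right left b<a b-odd) , 3<B
  ... | tri≈ _ refl _ = ⊥-elim (parity-disjoint a-even b-odd)
  ... | tri> _ _ a<b = B<A (tails-preserved left right a<b a-even) , 3<B
  part₂ : (Even b × Even a × b ℕ.< a) → (A <ᵣ B) × (three <ᵣ A)
  part₂ (b-even , _ , b<a) =
    <ᵣ-transport A B A≡ᵐ B≡ᵐ (approx-B<A left right (tails-preserved right left b<a b-even)) ,
    <ᵣ-transport three A (λ _ → refl) A≡ᵐ (approx-3<B left right k-odd k<a)
  part₃ : (C <ᵣ B) × (D <ᵣ A)
  part₃ = <ᵣ-transport C B C≡ B≡ (approx-C<B right left k-odd k<b) ,
          <ᵣ-transport D A (mirrored D 0 (4 ℕ.+ k) D≡) A≡ᵐ (approx-C<B left right k-odd k<a)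

-- Reading ω

mirror : ℕ → (ℤ → ℕ) → ℕ → ℕ
mirror k ω j = ω (+ suc k ℤ.- + j)

⊖-+-suc : ∀ n m → n ℤ.⊖ (n ℕ.+ suc m) ≡ -[1+ m ]
⊖-+-suc zero m = refl
⊖-+-suc (suc n) m = trans (ℤP.[1+m]⊖[1+n]≡m⊖n n (n ℕ.+ suc m)) (⊖-+-suc n m)

mirror-left : ∀ k m → + suc k ℤ.- + (2 ℕ.+ k ℕ.+ m) ≡ -[1+ m ]
mirror-left k m = trans (ℤP.[1+m]⊖[1+n]≡m⊖n k (suc (k ℕ.+ m))) (trans (cong (k ℤ.⊖_) (sym (ℕP.+-suc k m))) (⊖-+-suc k m))

mirror-left-suc : ∀ k m → + suc k ℤ.- + (3 ℕ.+ k ℕ.+ m) ≡ -[1+ suc m ]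
mirror-left-suc k m = trans (cong (λ x → + suc k ℤ.- + x) (sym (ℕP.+-suc (2 ℕ.+ k) m))) (mirror-left k (suc m))

lam-approx : ∀ ω i s s' p q → ω i ≡ 2 →
  (∀ m → ω (i ℤ.+ + suc m) ≡ s (p ℕ.+ m)) → (∀ m → ω (i ℤ.- + suc m) ≡ s' (q ℕ.+ m)) →
  ∀ n → lam ω i n ≡ approx s s' p q n
lam-approx ω i s s' p q centre forward backward n = cong₂ _+_
  (cong₂ _+_ (cong ⟦_⟧ centre) (cong cf (trans (List.map-upTo _ n) (applyUpTo-word _ s p n forward))))
  (cong cf (trans (List.map-upTo _ n) (applyUpTo-word _ s' q n backward)))

module _ (k : ℕ) (ω : ℤ → ℕ) where
  private
    s = λ j → ω (+ j)
    s' = mirror k ω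

  lam-A : ω (+ 0) ≡ 2 → ∀ n → lam ω (+ 0) n ≡ approx s s' 1 (2 ℕ.+ k) n
  lam-A centre = lam-approx ω (+ 0) s s' 1 (2 ℕ.+ k) centre (λ _ → refl) (λ m → cong ω (sym (mirror-left k m)))

  lam-B : ω (+ (k ℕ.+ 1)) ≡ 2 → ∀ n → lam ω (+ (k ℕ.+ 1)) n ≡ approx s s' (2 ℕ.+ k) 1 n
  lam-B centre = lam-approx ω (+ (k ℕ.+ 1)) s s' (2 ℕ.+ k) 1 centre
    (λ m → cong (λ x → ω (+ x)) (arith k m))
    (λ m → cong (λ x → ω (+ x ℤ.- + suc m)) (ℕP.+-comm k 1))
    where
    arith : ∀ k m → k ℕ.+ 1 ℕ.+ suc m ≡ 2 ℕ.+ k ℕ.+ m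
    arith = ℕSolver.solve-∀

  lam-C : ω (+ (k ℕ.+ 2)) ≡ 2 → ∀ n → lam ω (+ (k ℕ.+ 2)) n ≡ approx s s' (3 ℕ.+ k) 0 n
  lam-C centre = lam-approx ω (+ (k ℕ.+ 2)) s s' (3 ℕ.+ k) 0 centre
    (λ m → cong (λ x → ω (+ x)) (arith k m))
    (λ m → cong ω (trans (cong (ℤ._⊖ suc m) (ℕP.+-comm k 2))
                    (trans (ℤP.[1+m]⊖[1+n]≡m⊖n (suc k) m) (sym (ℤP.m-n≡m⊖n (suc k) m)))))
    where
    arith : ∀ k m → k ℕ.+ 2 ℕ.+ suc m ≡ 3 ℕ.+ k ℕ.+ m
    arith = ℕSolver.solve-∀

  lam-D : ω (- (+ 1)) ≡ 2 → ∀ n → lam ω (- (+ 1)) n ≡ approx s s' 0 (3 ℕ.+ k) n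
  lam-D centre = lam-approx ω (- (+ 1)) s s' 0 (3 ℕ.+ k) centre (λ _ → refl)
    (λ m → cong ω (sym (mirror-left-suc k m)))

  right-pattern : ∀ {b} → (∀ j → Digit (ω j)) → ω (+ 0) ≡ 2 →
    (∀ j → + 1 ℤ.≤ j → j ℤ.≤ + k → ω j ≡ 1) → ω (+ (k ℕ.+ 1)) ≡ 2 → ω (+ (k ℕ.+ 2)) ≡ 2 →
    (∀ j → + (k ℕ.+ 3) ℤ.≤ j → j ℤ.≤ + (k ℕ.+ b ℕ.+ 2) → ω j ≡ 1) → ω (+ (k ℕ.+ b ℕ.+ 3)) ≡ 2 →
    Pattern k b s
  right-pattern {b} digit centre run₁ pair₁ pair₂ run₂ end = record
    { digit = λ j → digit (+ j)
    ; centre = centre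
    ; run₁ = λ m m<k → run₁ (+ suc m) (ℤ.+≤+ (ℕ.s≤s ℕ.z≤n)) (ℤ.+≤+ m<k)
    ; pair₁ = subst (λ x → ω (+ x) ≡ 2) (ℕP.+-comm k 1) pair₁
    ; pair₂ = subst (λ x → ω (+ x) ≡ 2) (ℕP.+-comm k 2) pair₂
    ; run₂ = λ m m<b → run₂ (+ (3 ℕ.+ k ℕ.+ m))
        (ℤ.+≤+ (subst (ℕ._≤ 3 ℕ.+ k ℕ.+ m) (ℕP.+-comm 3 k) (ℕP.m≤m+n (3 ℕ.+ k) m)))
        (ℤ.+≤+ (subst₂ ℕ._≤_ (arith₁ k m) (arith₂ k b) (ℕP.+-monoʳ-≤ (2 ℕ.+ k) m<b)))
    ; end = subst (λ x → ω (+ x) ≡ 2) (arith₃ k b) end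
    }
    where
    arith₁ : ∀ k m → 2 ℕ.+ k ℕ.+ suc m ≡ 3 ℕ.+ k ℕ.+ m
    arith₁ = ℕSolver.solve-∀
    arith₂ : ∀ k b → 2 ℕ.+ k ℕ.+ b ≡ k ℕ.+ b ℕ.+ 2
    arith₂ = ℕSolver.solve-∀
    arith₃ : ∀ k b → k ℕ.+ b ℕ.+ 3 ≡ 3 ℕ.+ k ℕ.+ b
    arith₃ = ℕSolver.solve-∀

  left-pattern : ∀ {a} → (∀ j → Digit (ω j)) → ω (+ (k ℕ.+ 1)) ≡ 2 →
    (∀ j → + 1 ℤ.≤ j → j ℤ.≤ + k → ω j ≡ 1) → ω (+ 0) ≡ 2 → ω (- (+ 1)) ≡ 2 →
    (∀ j → - (+ (a ℕ.+ 1)) ℤ.≤ j → j ℤ.≤ - (+ 2) → ω j ≡ 1) → ω (- (+ (a ℕ.+ 2))) ≡ 2 →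
    Pattern k a s'
  left-pattern {a} digit centre run₁ pair₁ pair₂ run₂ end = record
    { digit = λ j → digit _
    ; centre = subst (λ x → ω (+ x) ≡ 2) (trans (ℕP.+-comm k 1) (sym (ℕP.+-identityʳ (suc k)))) centre
    ; run₁ = λ m m<k → subst (λ x → ω x ≡ 1) (sym (trans (ℤP.[1+m]⊖[1+n]≡m⊖n k m) (ℤP.⊖-≥ (ℕP.<⇒≤ m<k))))
        (run₁ (+ (k ℕ.∸ m)) (ℤ.+≤+ (ℕP.m<n⇒0<n∸m m<k)) (ℤ.+≤+ (ℕP.m∸n≤m k m)))
    ; pair₁ = subst (λ x → ω x ≡ 2) (sym (trans (ℤP.[1+m]⊖[1+n]≡m⊖n k k) (ℤP.n⊖n≡0 k))) pair₁
    ; pair₂ = subst (λ x → ω x ≡ 2) (sym (trans (cong (λ x → + suc k ℤ.- + x) (sym (ℕP.+-identityʳ (2 ℕ.+ k)))) (mirror-left k 0))) pair₂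
    ; run₂ = λ m m<a → subst (λ x → ω x ≡ 1) (sym (mirror-left-suc k m))
        (run₂ -[1+ suc m ] (subst (λ x → - (+ x) ℤ.≤ -[1+ suc m ]) (ℕP.+-comm 1 a) (ℤ.-≤- m<a)) (ℤ.-≤- (ℕ.s≤s ℕ.z≤n)))
    ; end = subst (λ x → ω x ≡ 2) (trans (cong (λ x → - (+ x)) (ℕP.+-comm a 2)) (sym (mirror-left-suc k a))) end
    }

lemma2p2 : (k₀ k₁ k₋₁ : ℕ) → Odd k₀ → 3 ℕ.≤ k₀ → k₀ ℕ.< k₁ → k₀ ℕ.< k₋₁ →
    (ω : ℤ → ℕ) → ((j : ℤ) → (ω j ≡ 1) ⊎ (ω j ≡ 2)) →
    ω (- (+ (k₋₁ ℕ.+ 2))) ≡ 2 →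
    ((j : ℤ) → - (+ (k₋₁ ℕ.+ 1)) ℤ.≤ j → j ℤ.≤ - (+ 2) → ω j ≡ 1) →
    ω (- (+ 1)) ≡ 2 → ω (+ 0) ≡ 2 →
    ((j : ℤ) → + 1 ℤ.≤ j → j ℤ.≤ + k₀ → ω j ≡ 1) →
    ω (+ (k₀ ℕ.+ 1)) ≡ 2 → ω (+ (k₀ ℕ.+ 2)) ≡ 2 →
    ((j : ℤ) → + (k₀ ℕ.+ 3) ℤ.≤ j → j ℤ.≤ + (k₀ ℕ.+ k₁ ℕ.+ 2) → ω j ≡ 1) →
    ω (+ (k₀ ℕ.+ k₁ ℕ.+ 3)) ≡ 2 →
    (((Even k₋₁ × Odd k₁) ⊎ (Odd k₁ × Odd k₋₁ × k₁ ℕ.< k₋₁)) →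
        (lam ω (+ (k₀ ℕ.+ 1)) <ᵣ lam ω (+ 0)) × (three <ᵣ lam ω (+ (k₀ ℕ.+ 1))))
    × ((Even k₁ × Even k₋₁ × k₁ ℕ.< k₋₁) →
        (lam ω (+ 0) <ᵣ lam ω (+ (k₀ ℕ.+ 1))) × (three <ᵣ lam ω (+ 0)))
    × ((lam ω (+ (k₀ ℕ.+ 2)) <ᵣ lam ω (+ (k₀ ℕ.+ 1))) × (lam ω (- (+ 1)) <ᵣ lam ω (+ 0)))
lemma2p2 k₀ k₁ k₋₁ (m , refl) _ k₀<k₁ k₀<k₋₁ ω digit end₋ run₋ centre₋ centre run₁ pair₁ pair₂ run₂ end₊ =
  λ-comparisons
    (right-pattern k₀ ω digit centre run₁ pair₁ pair₂ run₂ end₊)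
    (left-pattern k₀ ω digit pair₁ run₁ centre centre₋ run₋ end₋)
    (m , refl) k₀<k₁ k₀<k₋₁
    (lam-A k₀ ω centre) (lam-B k₀ ω pair₁) (lam-C k₀ ω pair₂) (lam-D k₀ ω centre₋)
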